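{- Let $k\ge 2$ and $X\subseteq V(G_k)$ with $\operatorname{mm}(X)<k$. Then $R_i\subseteq X$ for some $i$ if and only if $C_j\subseteq X$ for some $j$.
   Context: $G_k$ is the $k\times k$-grid with vertex set $\{(i,j):1\le i,j\le k\}$ and edges $(i,j)(i',j')$ with $|i-i'|+|j-j'|=1$. $C_i=\{(i,j):1\le j\le k\}$ and $R_j=\{(i,j):1\le i\le k\}$. For $X\subseteq V(G_k)$, $\operatorname{mm}(X)$ is the size of a maximum matching in $G_k$ among the edges with one end in $X$ and the other in $V(G_k)\setminus X$. -}

module Defs where

open import Data.Nat using (ℕ; suc; _+_; ∣_-_∣)
open import Data.Fin using (Fin; toℕ)
open import Data.Bool using (Bool; true; false)
open import Data.Product using (_×_; _,_; proj₁; proj₂)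
open import Data.List using (List; []; _∷_; concatMap)
open import Data.List.Relation.Unary.All using (All)
open import Data.List.Relation.Unary.Unique.Propositional using (Unique)
open import Relation.Binary.PropositionalEquality using (_≡_)

-- vertices of the k×k grid G_k: (i , j) with i,j ∈ {1..k} (0-indexed via Fin k)
Vertex : ℕ → Set
Vertex k = Fin k × Fin k

Adj : {k : ℕ} → Vertex k → Vertex k → Set
Adj (i , j) (i' , j') = ∣ toℕ i - toℕ i' ∣ + ∣ toℕ j - toℕ j' ∣ ≡ 1

VSet : ℕ → Set
VSet k = Vertex k → Bool

CutEdge : {k : ℕ} → VSet k → Vertex k × Vertex k → Set
CutEdge X (u , v) = Adj u v × (X u ≡ true) × (X v ≡ false)

endpoints : {k : ℕ} → List (Vertex k × Vertex k) → List (Vertex k)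
endpoints = concatMap (λ e → proj₁ e ∷ proj₂ e ∷ [])

IsCutMatching : {k : ℕ} → VSet k → List (Vertex k × Vertex k) → Set
IsCutMatching X M = All (CutEdge X) M × Unique (endpoints M)

-- If some row lies in X but no column does, every column meets both X and its complement, so
-- each column contains an edge leaving X.  These k edges lie in distinct columns, hence form a
-- cut matching of size k, contradicting mm(X) < k.  The converse follows by transposing the grid.
module Submission where

open import Defs
open import Data.Bool using (Bool; true; false)
open import Data.Bool.Properties using (¬-not) renaming (_≟_ to _≟ᵇ_)
open import Data.Empty using (⊥-elim)
open import Data.Fin using (Fin; toℕ; zero; suc; inject₁)
open import Data.Fin.Properties using (toℕ-inject₁; any?; all?; ¬∀⟶∃¬)
open import Data.List using (List; []; _∷_; map; length; allFin)
open import Data.List.Properties using (length-map; length-tabulate)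
open import Data.List.Relation.Unary.All as All using (All; []; _∷_; universal)
open import Data.List.Relation.Unary.All.Properties using (map⁺)
open import Data.List.Relation.Unary.AllPairs using ([]; _∷_)
open import Data.List.Relation.Unary.Unique.Propositional using (Unique)
import Data.List.Relation.Unary.Unique.Propositional.Properties as Unique
open import Data.Nat as ℕ using (ℕ; _≤_; _<_; ∣_-_∣)
open import Data.Nat.Properties using (<-irrefl; +-comm; ∣n-n∣≡0; ∣m-m+n∣≡n; ∣-∣-comm)
open import Data.Product using (_×_; _,_; proj₁; proj₂; ∃; ∃₂; swap)
open import Function using (_∘_)
open import Function.Bundles using (_⇔_; mk⇔)
open import Relation.Nullary using (yes; no; contradiction)
open import Relation.Binary.PropositionalEquality using (_≡_; _≢_; refl; sym; trans; cong; subst)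

∣n-1+n∣≡1 : ∀ n → ∣ n - ℕ.suc n ∣ ≡ 1
∣n-1+n∣≡1 n = subst (λ m → ∣ n - m ∣ ≡ 1) (+-comm n 1) (∣m-m+n∣≡n n 1)

stepwise-constant⇒constant : ∀ {a} {A : Set a} {n} (f : Fin (ℕ.suc n) → A) →
  (∀ i → f (inject₁ i) ≡ f (suc i)) → ∀ j → f j ≡ f zero
stepwise-constant⇒constant f step zero = refl
stepwise-constant⇒constant {n = ℕ.suc n} f step (suc j) =
  trans (stepwise-constant⇒constant (f ∘ suc) (step ∘ suc) j) (sym (step zero))

step-change : ∀ {n} (f : Fin (ℕ.suc n) → Bool) {a b} → f a ≢ f b →
  ∃ λ i → f (inject₁ i) ≢ f (suc i)
step-change {n} f {a} {b} fa≢fb =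
  ¬∀⟶∃¬ n _ (λ i → f (inject₁ i) ≟ᵇ f (suc i)) λ steps →
    fa≢fb (trans (stepwise-constant⇒constant f steps a) (sym (stepwise-constant⇒constant f steps b)))

∣inject₁-suc∣≡1 : ∀ {n} (i : Fin n) → ∣ toℕ (inject₁ i) - toℕ (suc i) ∣ ≡ 1
∣inject₁-suc∣≡1 i = trans (cong ∣_- toℕ (suc i) ∣ (toℕ-inject₁ i)) (∣n-1+n∣≡1 (toℕ i))

boundary-step : ∀ {n} (f : Fin n → Bool) {a b} → f a ≡ true → f b ≡ false →
  ∃₂ λ u v → ∣ toℕ u - toℕ v ∣ ≡ 1 × f u ≡ true × f v ≡ false
boundary-step {ℕ.suc n} f fa fb
  with step-change f (λ fa≡fb → contradiction (trans (sym fa) (trans fa≡fb fb)) λ ())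
... | i , change with f (inject₁ i) in fi | f (suc i) in fsi
...   | true  | false = inject₁ i , suc i , ∣inject₁-suc∣≡1 i , fi , fsi
...   | false | true  =
  suc i , inject₁ i , trans (∣-∣-comm (toℕ (suc i)) (toℕ (inject₁ i))) (∣inject₁-suc∣≡1 i) , fsi , fi
...   | true  | true  = ⊥-elim (change refl)
...   | false | false = ⊥-elim (change refl)

Edge : ℕ → Set
Edge k = Vertex k × Vertex k

CutMatchingsShorterThan : ∀ {k} → VSet k → ℕ → Set
CutMatchingsShorterThan {k} X n = (M : List (Edge k)) → IsCutMatching X M → length M < n

cutEdge-distinct : ∀ {k} {X : VSet k} {u v} → CutEdge X (u , v) → u ≢ v
cutEdge-distinct (_ , Xu , Xv) refl with trans (sym Xu) Xv
... | ()

adj-inColumn : ∀ {k} (i : Fin k) {j j′ : Fin k} → ∣ toℕ j - toℕ j′ ∣ ≡ 1 → Adj (i , j) (i , j′)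
adj-inColumn i adj = trans (cong (ℕ._+ _) (∣n-n∣≡0 (toℕ i))) adj

module ColumnMatching {k} (X : VSet k) (a b : Fin k → Fin k)
                      (cut : ∀ i → CutEdge X ((i , a i) , (i , b i))) where

  columnEdge : Fin k → Edge k
  columnEdge i = (i , a i) , (i , b i)

  offColumn : ∀ {i x is} → All (i ≢_) is → All ((i , x) ≢_) (endpoints (map columnEdge is))
  offColumn [] = []
  offColumn (i≢j ∷ i≢is) = (i≢j ∘ cong proj₁) ∷ (i≢j ∘ cong proj₁) ∷ offColumn i≢is

  endpoints-unique : ∀ {is} → Unique is → Unique (endpoints (map columnEdge is))
  endpoints-unique [] = []
  endpoints-unique {i ∷ _} (i∉is ∷ unique) =
    (cutEdge-distinct {X = X} (cut i) ∷ offColumn i∉is) ∷ offColumn i∉is ∷ endpoints-unique unique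

  matching : List (Edge k)
  matching = map columnEdge (allFin k)

  isCutMatching : IsCutMatching X matching
  isCutMatching = map⁺ (universal cut (allFin k)) , endpoints-unique (Unique.allFin⁺ k)

  length-matching : length matching ≡ k
  length-matching = trans (length-map columnEdge (allFin k)) (length-tabulate (λ i → i))

FullColumn FullRow : ∀ {k} → VSet k → Set
FullColumn {k} X = ∃ λ (i : Fin k) → ∀ j → X (i , j) ≡ true
FullRow    {k} X = ∃ λ (j : Fin k) → ∀ i → X (i , j) ≡ true

fullRow⇒fullColumn : ∀ {k} (X : VSet k) → CutMatchingsShorterThan X k → FullRow X → FullColumn X
fullRow⇒fullColumn {k} X short (_ , row) with any? (λ i → all? (λ j → X (i , j) ≟ᵇ true))
... | yes column = column
... | no noColumn =
  ⊥-elim (<-irrefl refl (subst (_< k) length-matching (short matching isCutMatching)))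
  where
  outside : ∀ i → ∃ λ j → X (i , j) ≡ false
  outside i with ¬∀⟶∃¬ k _ (λ j → X (i , j) ≟ᵇ true) (λ column → noColumn (i , column))
  ... | j , Xij≢true = j , ¬-not Xij≢true

  crossing : ∀ i → ∃₂ λ u v → ∣ toℕ u - toℕ v ∣ ≡ 1 × X (i , u) ≡ true × X (i , v) ≡ false
  crossing i = boundary-step (λ j → X (i , j)) (row i) (proj₂ (outside i))

  crossingCut : ∀ i → CutEdge X ((i , proj₁ (crossing i)) , (i , proj₁ (proj₂ (crossing i))))
  crossingCut i with crossing i
  ... | u , v , adj , Xu , Xv = adj-inColumn i {u} {v} adj , Xu , Xv

  open ColumnMatching X (proj₁ ∘ crossing) (proj₁ ∘ proj₂ ∘ crossing) crossingCut

transposeEdge : ∀ {k} → Edge k → Edge k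
transposeEdge (u , v) = swap u , swap v

endpoints-transpose : ∀ {k} (M : List (Edge k)) →
  endpoints (map transposeEdge M) ≡ map swap (endpoints M)
endpoints-transpose [] = refl
endpoints-transpose ((u , v) ∷ M) = cong (λ vs → swap u ∷ swap v ∷ vs) (endpoints-transpose M)

cutEdge-transpose : ∀ {k} {X : VSet k} {e} → CutEdge (X ∘ swap) e → CutEdge X (transposeEdge e)
cutEdge-transpose {e = (i , j) , (i′ , j′)} (adj , inside , outside) =
  trans (+-comm ∣ toℕ j - toℕ j′ ∣ ∣ toℕ i - toℕ i′ ∣) adj , inside , outside

cutMatching-transpose : ∀ {k} {X : VSet k} {M} →
  IsCutMatching (X ∘ swap) M → IsCutMatching X (map transposeEdge M)
cutMatching-transpose {X = X} {M} (cuts , unique) =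
  map⁺ (All.map (cutEdge-transpose {X = X}) cuts) ,
  subst Unique (sym (endpoints-transpose M)) (Unique.map⁺ (cong swap) unique)

cutMatchingsShorterThan-transpose : ∀ {k n} {X : VSet k} →
  CutMatchingsShorterThan X n → CutMatchingsShorterThan (X ∘ swap) n
cutMatchingsShorterThan-transpose short M matching =
  subst (_< _) (length-map transposeEdge M)
        (short (map transposeEdge M) (cutMatching-transpose matching))

lemma4p2 : (k : ℕ) → 2 ≤ k → (X : VSet k) →
    ((M : List (Vertex k × Vertex k)) → IsCutMatching X M → length M < k) →
    (∃ λ (j : Fin k) → (i : Fin k) → X (i , j) ≡ true) ⇔ (∃ λ (i : Fin k) → (j : Fin k) → X (i , j) ≡ true)
lemma4p2 k _ X short =
  mk⇔ (fullRow⇒fullColumn X short)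
      (fullRow⇒fullColumn (X ∘ swap) (cutMatchingsShorterThan-transpose short))
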